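{- Let $P=([n],\preceq)$ be a poset and $m\ge 2$. Suppose $\mathcal{I}_P^{m-1}=\{I\cup\{a_1\},I\cup\{a_2\},I\cup\{a_3\}\}$, where $I\in\mathcal{I}_P^{m-2}$ and $a_1,a_2,a_3\in[n]\setminus I$. Let $h_1,\dots,h_n\in\mathbb{F}_2^m$ be such that the vectors $h_i$, $i\in I\cup\{a_1,a_2\}$, are linearly independent and $h_{a_3}=\sum_{i\in I}\alpha_i h_i+h_{a_1}+h_{a_2}$ for some $\alpha_i\in\{0,1\}$, $i\in I$. Then the linear code $\mathcal{C}=\{c\in F^n\mid \sum_{i\in c}h_i=0\}$ is an $(m-1)$-perfect $P$-code.
   Context: $[n]=\{1,\dots,n\}$; subsets of $[n]$ are identified with their characteristic vectors in $F^n=\{0,1\}^n$, and $x+y$ is the symmetric difference. An ideal of $P$ is a set $I\subseteq[n]$ such that $a\in I$ and $b\preceq a$ imply $b\in I$; ${<}X{>}$ is the smallest ideal containing $X$. $\mathcal{I}_P^r$ is the set of ideals of cardinality $r$. The $P$-weight is $w_P(x)=|{<}x{>}|$ and $\mathcal{B}_P^r=\{x\in F^n: w_P(x)\le r\}$. A $P$-code $\mathcal{C}\subseteq F^n$ is $r$-perfect if every $x\in F^n$ has exactly one representation $x=c+b$ with $c\in\mathcal{C}$, $b\in\mathcal{B}_P^r$. -}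

module Defs where

open import Data.Bool using (Bool; true; false; _xor_; _∧_; _∨_)
open import Data.Nat using (ℕ; zero; suc; _≤_)
open import Data.Fin using (Fin)
open import Data.Fin.Subset using (Subset; _∈_; _⊆_; ∣_∣)
open import Data.Vec using (Vec; []; _∷_; replicate; zipWith; tabulate; lookup; foldr)
open import Data.Product using (_×_; Σ; ∃)
open import Relation.Binary.PropositionalEquality using (_≡_)
open import Relation.Binary.Structures using (IsPartialOrder)
open import Relation.Binary.Definitions using (Decidable)
open import Relation.Nullary.Decidable using (⌊_⌋)
open import Level using (0ℓ)

-- The space F^n = {0,1}^n; vectors are identified with subsets of [n] (Subset n = Vec Bool n).
-- Addition = componentwise xor = symmetric difference.
infixl 6 _⊕_
_⊕_ : ∀ {k} → Vec Bool k → Vec Bool k → Vec Bool k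
_⊕_ = zipWith _xor_

𝟎 : ∀ {k} → Vec Bool k
𝟎 = replicate _ false

record Poset (n : ℕ) : Set₁ where
  field
    _≼_            : Fin n → Fin n → Set
    isPartialOrder : IsPartialOrder _≡_ _≼_
    _≼?_           : Decidable _≼_

module _ {n : ℕ} (P : Poset n) where
  open Poset P

  IsIdeal : Subset n → Set
  IsIdeal I = ∀ {a b} → a ∈ I → b ≼ a → b ∈ I

  -- <x> : the smallest ideal containing x, i.e. the down-set of x
  ⟨_⟩ : Subset n → Subset n
  ⟨ x ⟩ = tabulate (λ b → foldr _ _∨_ false
                             (tabulate (λ a → lookup x a ∧ ⌊ b ≼? a ⌋)))

  wP : Subset n → ℕ
  wP x = ∣ ⟨ x ⟩ ∣

  InBall : ℕ → Subset n → Set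
  InBall r x = wP x ≤ r

  IsPerfect : ℕ → (Subset n → Set) → Set
  IsPerfect r C =
    ∀ (x : Subset n) →
      Σ (Subset n) (λ c → Σ (Subset n) (λ b → C c × InBall r b × x ≡ c ⊕ b))
      × (∀ c b c′ b′ → C c → InBall r b → x ≡ c ⊕ b →
                       C c′ → InBall r b′ → x ≡ c′ ⊕ b′ → c ≡ c′ × b ≡ b′)

sumOver : ∀ {n m} → (Fin n → Vec Bool m) → Subset n → Vec Bool m
sumOver h c = foldr _ _⊕_ 𝟎 (tabulate (λ i → if′ lookup c i then h i))
  where
  if′_then_ : ∀ {m} → Bool → Vec Bool m → Vec Bool m
  if′ true  then v = v
  if′ false then v = 𝟎

LinIndepOn : ∀ {n m} → (Fin n → Vec Bool m) → Subset n → Set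
LinIndepOn {n} h S = ∀ (T : Subset n) → T ⊆ S → sumOver h T ≡ 𝟎 → T ≡ 𝟎

Code : ∀ {n m} → (Fin n → Vec Bool m) → Subset n → Set
Code h c = sumOver h c ≡ 𝟎

-- Write s(x) = Σ_{i ∈ x} h_i, so that the code is the kernel of s.  Since every ideal of size
-- m − 1 is one of I ∪ {a₁}, I ∪ {a₂}, I ∪ {a₃}, and the down-set of any x with w_P(x) ≤ m − 1
-- extends to an ideal of size exactly m − 1, the ball B_P^{m−1} consists of the x contained in one
-- of these three sets; the code is (m − 1)-perfect iff s maps this ball bijectively onto F₂^m.
-- Onto: the m independent h_i, i ∈ S = I ∪ {a₁, a₂}, span F₂^m, and a subset of S containing both
-- a₁ and a₂ is moved into I ∪ {a₃} by adding the codeword A = α + a₁ + a₂ + a₃.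
-- One-to-one: the only codewords supported in I ∪ {a₁, a₂, a₃} are 0 and A, and A has three points
-- outside I while the sum of two ball elements has at most two.
module Submission where

open import Defs

open import Data.Bool using (Bool; true; false; _xor_; _∨_; T; _≟_)
open import Data.Bool.Properties
  using (T-∨; T-∧; T-≡; ¬-not; xor-assoc; xor-comm; xor-identityˡ; xor-identityʳ; xor-same)
open import Data.Empty using (⊥; ⊥-elim)
open import Data.Fin using (Fin; zero; suc)
open import Data.Fin.Properties as Fin using (injective⇒≤; ¬∀⟶∃¬) renaming (_≟_ to _≟ᶠ_)
open import Data.Fin.Subset using (Subset; ⊤; _∈_; _∉_; _⊆_; _∪_; ⁅_⁆; ∣_∣)
open import Data.Fin.Subset.Properties
  using (_∈?_; x∈p∪q⁻; x∈p∪q⁺; x∈⁅x⁆; x∈⁅y⁆⇒x≡y; x≢y⇒x∉⁅y⁆; p⊆p∪q; ⊆⊤; ⊆-refl; out⊆; in⊆in; drop-∷-⊆;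
         ∪-assoc; ∪-identityʳ; ∣p∣≤n; ∣⊤∣≡n; p⊆q⇒∣p∣≤∣q∣; p⊂q⇒∣p∣<∣q∣)
open import Data.List using (List; []; _∷_; _++_; map; length)
import Data.List as List
open import Data.List.Properties using (length-map; length-++)
open import Data.List.Membership.Propositional using (find; lose) renaming (_∈_ to _∈ₗ_)
open import Data.List.Membership.Propositional.Properties
  using (∈-lookup; ∈-map⁺; ∈-map⁻; ∈-++⁺ˡ; ∈-++⁺ʳ; ∈-++⁻)
import Data.List.Relation.Unary.All as All
open import Data.List.Relation.Unary.AllPairs using ([]; _∷_)
open import Data.List.Relation.Unary.Any as Any using (index; any?)
open import Data.List.Relation.Unary.Any.Properties using (lookup-index)
open import Data.List.Relation.Unary.Unique.Propositional using (Unique)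
import Data.List.Relation.Unary.Unique.Propositional.Properties as Unique
open import Data.Nat using (ℕ; zero; suc; _≤_; _<_; _∸_; _+_; _^_; z≤n; s≤s; z<s)
open import Data.Nat.Induction using (<-wellFounded)
open import Data.Nat.Properties
  using (≤-reflexive; m<m+n; <-≤-trans; ≤-<-trans; <-irrefl; +-suc; +-identityʳ; m+[n∸m]≡n; ^-monoʳ-≤;
         module ≤-Reasoning)
open import Data.Product using (Σ; ∃; _×_; _,_)
open import Data.Sum using (_⊎_; inj₁; inj₂; [_,_])
import Data.Sum as Sum
open import Data.Vec using (Vec; []; _∷_; lookup; here; there; foldr; tabulate)
open import Data.Vec.Properties
  using (zipWith-assoc; zipWith-comm; zipWith-identityˡ; zipWith-identityʳ; lookup-zipWith; lookup∘tabulate;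
         []=⇒lookup; lookup⇒[]=; ∷-injectiveʳ; ≡-dec)
open import Function using (_∘_; id; Injective)
open import Function.Bundles using (module Equivalence)
open import Induction.WellFounded using (Acc; acc)
open import Relation.Binary.PropositionalEquality
  using (_≡_; _≢_; refl; sym; trans; cong; cong₂; subst; module ≡-Reasoning)
open import Relation.Binary.Structures using (IsPartialOrder)
open import Relation.Nullary using (¬_; yes; no)
open import Relation.Nullary.Decidable using (toWitness; fromWitness; _×-dec_; ¬?)

⊕-assoc : ∀ {k} (u v w : Vec Bool k) → u ⊕ v ⊕ w ≡ u ⊕ (v ⊕ w)
⊕-assoc = zipWith-assoc xor-assoc

⊕-comm : ∀ {k} (u v : Vec Bool k) → u ⊕ v ≡ v ⊕ u
⊕-comm = zipWith-comm xor-comm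

⊕-identityˡ : ∀ {k} (u : Vec Bool k) → 𝟎 ⊕ u ≡ u
⊕-identityˡ = zipWith-identityˡ xor-identityˡ

⊕-identityʳ : ∀ {k} (u : Vec Bool k) → u ⊕ 𝟎 ≡ u
⊕-identityʳ = zipWith-identityʳ xor-identityʳ

⊕-self : ∀ {k} (u : Vec Bool k) → u ⊕ u ≡ 𝟎
⊕-self []      = refl
⊕-self (b ∷ u) = cong₂ _∷_ (xor-same b) (⊕-self u)

⊕-cancelʳ : ∀ {k} (u v : Vec Bool k) → u ⊕ v ⊕ v ≡ u
⊕-cancelʳ u v = begin
  u ⊕ v ⊕ v   ≡⟨ ⊕-assoc u v v ⟩
  u ⊕ (v ⊕ v) ≡⟨ cong (u ⊕_) (⊕-self v) ⟩
  u ⊕ 𝟎       ≡⟨ ⊕-identityʳ u ⟩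
  u           ∎
  where open ≡-Reasoning

⊕≡𝟎⇒≡ : ∀ {k} {u v : Vec Bool k} → u ⊕ v ≡ 𝟎 → u ≡ v
⊕≡𝟎⇒≡ {u = u} {v} eq = begin
  u         ≡⟨ ⊕-cancelʳ u v ⟨
  u ⊕ v ⊕ v ≡⟨ cong (_⊕ v) eq ⟩
  𝟎 ⊕ v     ≡⟨ ⊕-identityˡ v ⟩
  v         ∎
  where open ≡-Reasoning

⊕-interchange : ∀ {k} (u v w x : Vec Bool k) → (u ⊕ v) ⊕ (w ⊕ x) ≡ (u ⊕ w) ⊕ (v ⊕ x)
⊕-interchange u v w x = begin
  u ⊕ v ⊕ (w ⊕ x)     ≡⟨ ⊕-assoc u v (w ⊕ x) ⟩
  u ⊕ (v ⊕ (w ⊕ x))   ≡⟨ cong (u ⊕_) (⊕-assoc v w x) ⟨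
  u ⊕ (v ⊕ w ⊕ x)     ≡⟨ cong (λ z → u ⊕ (z ⊕ x)) (⊕-comm v w) ⟩
  u ⊕ (w ⊕ v ⊕ x)     ≡⟨ cong (u ⊕_) (⊕-assoc w v x) ⟩
  u ⊕ (w ⊕ (v ⊕ x))   ≡⟨ ⊕-assoc u w (v ⊕ x) ⟨
  u ⊕ w ⊕ (v ⊕ x)     ∎
  where open ≡-Reasoning

infixr 7 _·_
_·_ : ∀ {k} → Bool → Vec Bool k → Vec Bool k
true  · u = u
false · u = 𝟎

·-distribʳ-xor : ∀ {k} a b (u : Vec Bool k) → (a xor b) · u ≡ a · u ⊕ b · u
·-distribʳ-xor true  true  u = sym (⊕-self u)
·-distribʳ-xor true  false u = sym (⊕-identityʳ u)
·-distribʳ-xor false b     u = sym (⊕-identityˡ (b · u))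

-- The case split inside sumOver is a local function of Defs that cannot be named here; _·_ restates it.
sumOver-∷ : ∀ {n m} (h : Fin (suc n) → Vec Bool m) a c →
            sumOver h (a ∷ c) ≡ a · h zero ⊕ sumOver (h ∘ suc) c
sumOver-∷ h true  c = refl
sumOver-∷ h false c = refl

sumOver-⊕ : ∀ {n m} (h : Fin n → Vec Bool m) (c d : Subset n) →
            sumOver h (c ⊕ d) ≡ sumOver h c ⊕ sumOver h d
sumOver-⊕ h []      []      = sym (⊕-self 𝟎)
sumOver-⊕ h (a ∷ c) (b ∷ d) = begin
  sumOver h ((a xor b) ∷ (c ⊕ d))
    ≡⟨ sumOver-∷ h (a xor b) (c ⊕ d) ⟩
  (a xor b) · h zero ⊕ sumOver h′ (c ⊕ d)
    ≡⟨ cong₂ _⊕_ (·-distribʳ-xor a b (h zero)) (sumOver-⊕ h′ c d) ⟩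
  (a · h zero ⊕ b · h zero) ⊕ (sumOver h′ c ⊕ sumOver h′ d)
    ≡⟨ ⊕-interchange (a · h zero) (b · h zero) (sumOver h′ c) (sumOver h′ d) ⟩
  (a · h zero ⊕ sumOver h′ c) ⊕ (b · h zero ⊕ sumOver h′ d)
    ≡⟨ cong₂ _⊕_ (sumOver-∷ h a c) (sumOver-∷ h b d) ⟨
  sumOver h (a ∷ c) ⊕ sumOver h (b ∷ d) ∎
  where
  open ≡-Reasoning
  h′ = h ∘ suc

sumOver-𝟎 : ∀ {n m} (h : Fin n → Vec Bool m) → sumOver h 𝟎 ≡ 𝟎
sumOver-𝟎 {zero}  h = refl
sumOver-𝟎 {suc n} h = trans (⊕-identityˡ _) (sumOver-𝟎 (h ∘ suc))

sumOver-⁅⁆ : ∀ {n m} (h : Fin n → Vec Bool m) a → sumOver h ⁅ a ⁆ ≡ h a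
sumOver-⁅⁆ h zero    = trans (cong (h zero ⊕_) (sumOver-𝟎 (h ∘ suc))) (⊕-identityʳ (h zero))
sumOver-⁅⁆ h (suc a) = trans (⊕-identityˡ _) (sumOver-⁅⁆ (h ∘ suc) a)

sumOver-⊕≡𝟎 : ∀ {n m} (h : Fin n → Vec Bool m) c d → sumOver h c ≡ sumOver h d → sumOver h (c ⊕ d) ≡ 𝟎
sumOver-⊕≡𝟎 h c d eq = begin
  sumOver h (c ⊕ d)           ≡⟨ sumOver-⊕ h c d ⟩
  sumOver h c ⊕ sumOver h d   ≡⟨ cong (_⊕ sumOver h d) eq ⟩
  sumOver h d ⊕ sumOver h d   ≡⟨ ⊕-self (sumOver h d) ⟩
  𝟎                           ∎
  where open ≡-Reasoning

module _ {n : ℕ} {x : Fin n} {p q : Subset n} where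

  private
    lookup-⊕ : lookup (p ⊕ q) x ≡ lookup p x xor lookup q x
    lookup-⊕ = lookup-zipWith _xor_ x p q

  x∈p⊕q⁻ : x ∈ p ⊕ q → x ∈ p ⊎ x ∈ q
  x∈p⊕q⁻ x∈p⊕q with lookup p x in px
  ... | true  = inj₁ (lookup⇒[]= x p px)
  ... | false = inj₂ (lookup⇒[]= x q (begin
    lookup q x                 ≡⟨ cong (_xor lookup q x) px ⟨
    lookup p x xor lookup q x  ≡⟨ lookup-⊕ ⟨
    lookup (p ⊕ q) x           ≡⟨ []=⇒lookup x∈p⊕q ⟩
    true                       ∎))
    where open ≡-Reasoning

  x∈p⊕q⁺ˡ : x ∈ p → x ∉ q → x ∈ p ⊕ q
  x∈p⊕q⁺ˡ x∈p x∉q = lookup⇒[]= x (p ⊕ q) (begin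
    lookup (p ⊕ q) x           ≡⟨ lookup-⊕ ⟩
    lookup p x xor lookup q x  ≡⟨ cong₂ _xor_ ([]=⇒lookup x∈p) (¬-not (x∉q ∘ lookup⇒[]= x q)) ⟩
    true                       ∎)
    where open ≡-Reasoning

  x∈p⊕q⁺ʳ : x ∉ p → x ∈ q → x ∈ p ⊕ q
  x∈p⊕q⁺ʳ x∉p x∈q = lookup⇒[]= x (p ⊕ q) (begin
    lookup (p ⊕ q) x           ≡⟨ lookup-⊕ ⟩
    lookup p x xor lookup q x  ≡⟨ cong₂ _xor_ (¬-not (x∉p ∘ lookup⇒[]= x p)) ([]=⇒lookup x∈q) ⟩
    true                       ∎)
    where open ≡-Reasoning

  x∈p∩q⇒x∉p⊕q : x ∈ p → x ∈ q → x ∉ p ⊕ q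
  x∈p∩q⇒x∉p⊕q x∈p x∈q x∈p⊕q
    with () ← trans (sym ([]=⇒lookup x∈p⊕q)) (trans lookup-⊕ (cong₂ _xor_ ([]=⇒lookup x∈p) ([]=⇒lookup x∈q)))

  x∉p⊕q⁺ : x ∉ p → x ∉ q → x ∉ p ⊕ q
  x∉p⊕q⁺ x∉p x∉q = [ x∉p , x∉q ] ∘ x∈p⊕q⁻

⊕-⊆ : ∀ {n} {p q r : Subset n} → p ⊆ r → q ⊆ r → p ⊕ q ⊆ r
⊕-⊆ p⊆r q⊆r x∈p⊕q = [ p⊆r , q⊆r ] (x∈p⊕q⁻ x∈p⊕q)

∪-⊆ : ∀ {n} {p q r : Subset n} → p ⊆ r → q ⊆ r → p ∪ q ⊆ r
∪-⊆ {p = p} {q} p⊆r q⊆r x∈p∪q = [ p⊆r , q⊆r ] (x∈p∪q⁻ p q x∈p∪q)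

⁅x⁆⊆p : ∀ {n} {x : Fin n} {p} → x ∈ p → ⁅ x ⁆ ⊆ p
⁅x⁆⊆p {p = p} x∈p y∈⁅x⁆ = subst (_∈ p) (sym (x∈⁅y⁆⇒x≡y _ y∈⁅x⁆)) x∈p

x∈p∪⁅y⁆⁻ : ∀ {n} {x y : Fin n} {p} → x ∈ p ∪ ⁅ y ⁆ → x ∈ p ⊎ x ≡ y
x∈p∪⁅y⁆⁻ {y = y} {p} = Sum.map₂ (x∈⁅y⁆⇒x≡y y) ∘ x∈p∪q⁻ p ⁅ y ⁆

x∈p∪⁅y⁆∪⁅z⁆⁻ : ∀ {n} {x y z : Fin n} {p} → x ∈ p ∪ ⁅ y ⁆ ∪ ⁅ z ⁆ → x ∈ p ⊎ x ≡ y ⊎ x ≡ z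
x∈p∪⁅y⁆∪⁅z⁆⁻ {y = y} {z} {p} =
  Sum.map₂ (Sum.map (x∈⁅y⁆⇒x≡y y) (x∈⁅y⁆⇒x≡y z) ∘ x∈p∪q⁻ ⁅ y ⁆ ⁅ z ⁆) ∘ x∈p∪q⁻ p _

⊆∪⁅⁆∪⁅⁆-dropˡ : ∀ {n} {y z : Fin n} {p q} → q ⊆ p ∪ ⁅ y ⁆ ∪ ⁅ z ⁆ → y ∉ q → q ⊆ p ∪ ⁅ z ⁆
⊆∪⁅⁆∪⁅⁆-dropˡ q⊆ y∉q x∈q with x∈p∪⁅y⁆∪⁅z⁆⁻ (q⊆ x∈q)
... | inj₁ x∈p        = x∈p∪q⁺ (inj₁ x∈p)
... | inj₂ (inj₁ refl) = ⊥-elim (y∉q x∈q)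
... | inj₂ (inj₂ refl) = x∈p∪q⁺ (inj₂ (x∈⁅x⁆ _))

⊆∪⁅⁆∪⁅⁆-dropʳ : ∀ {n} {y z : Fin n} {p q} → q ⊆ p ∪ ⁅ y ⁆ ∪ ⁅ z ⁆ → z ∉ q → q ⊆ p ∪ ⁅ y ⁆
⊆∪⁅⁆∪⁅⁆-dropʳ q⊆ z∉q x∈q with x∈p∪⁅y⁆∪⁅z⁆⁻ (q⊆ x∈q)
... | inj₁ x∈p        = x∈p∪q⁺ (inj₁ x∈p)
... | inj₂ (inj₁ refl) = x∈p∪q⁺ (inj₂ (x∈⁅x⁆ _))
... | inj₂ (inj₂ refl) = ⊥-elim (z∉q x∈q)

⊕-⊆-∪⁅⁆ : ∀ {n} {x y : Fin n} {p q q′} → q ⊆ p ∪ ⁅ x ⁆ → q′ ⊆ p ∪ ⁅ y ⁆ → q ⊕ q′ ⊆ p ∪ ⁅ x ⁆ ∪ ⁅ y ⁆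
⊕-⊆-∪⁅⁆ {x = x} {y} {p} q⊆ q′⊆ =
  ⊕-⊆ (∪-⊆ (p⊆p∪q _) (⁅x⁆⊆p x∈p∪x∪y) ∘ q⊆) (∪-⊆ (p⊆p∪q _) (⁅x⁆⊆p y∈p∪x∪y) ∘ q′⊆)
  where
  x∈p∪x∪y : x ∈ p ∪ ⁅ x ⁆ ∪ ⁅ y ⁆
  x∈p∪x∪y = x∈p∪q⁺ (inj₂ (x∈p∪q⁺ (inj₁ (x∈⁅x⁆ x))))
  y∈p∪x∪y : y ∈ p ∪ ⁅ x ⁆ ∪ ⁅ y ⁆
  y∈p∪x∪y = x∈p∪q⁺ (inj₂ (x∈p∪q⁺ (inj₂ (x∈⁅x⁆ y))))

∣p∪⁅x⁆∣≡1+∣p∣ : ∀ {n} {p : Subset n} {x} → x ∉ p → ∣ p ∪ ⁅ x ⁆ ∣ ≡ suc ∣ p ∣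
∣p∪⁅x⁆∣≡1+∣p∣ {p = true  ∷ p} {zero}  x∉p = ⊥-elim (x∉p here)
∣p∪⁅x⁆∣≡1+∣p∣ {p = false ∷ p} {zero}  _   = cong (suc ∘ ∣_∣) (∪-identityʳ p)
∣p∪⁅x⁆∣≡1+∣p∣ {p = true  ∷ p} {suc x} x∉p = cong suc (∣p∪⁅x⁆∣≡1+∣p∣ (x∉p ∘ there))
∣p∪⁅x⁆∣≡1+∣p∣ {p = false ∷ p} {suc x} x∉p = ∣p∪⁅x⁆∣≡1+∣p∣ (x∉p ∘ there)

module _ {A : Set} where

  Unique⇒lookup-injective : ∀ {xs : List A} → Unique xs → Injective _≡_ _≡_ (List.lookup xs)
  Unique⇒lookup-injective {x ∷ xs} _            {zero}  {zero}  _  = refl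
  Unique⇒lookup-injective {x ∷ xs} (x∉xs ∷ _)   {zero}  {suc j} eq = ⊥-elim (All.lookup x∉xs (∈-lookup j) eq)
  Unique⇒lookup-injective {x ∷ xs} (x∉xs ∷ _)   {suc i} {zero}  eq = ⊥-elim (All.lookup x∉xs (∈-lookup i) (sym eq))
  Unique⇒lookup-injective {x ∷ xs} (_ ∷ unique) {suc i} {suc j} eq = cong suc (Unique⇒lookup-injective unique eq)

  injective-into⇒≤-length : ∀ {k} {f : Fin k → A} (ys : List A) →
                            Injective _≡_ _≡_ f → (∀ i → f i ∈ₗ ys) → k ≤ length ys
  injective-into⇒≤-length ys f-injective f∈ys = injective⇒≤ {f = index ∘ f∈ys} λ {i} {j} eq →
    f-injective (trans (lookup-index (f∈ys i)) (trans (cong (List.lookup ys) eq) (sym (lookup-index (f∈ys j)))))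

subsetsOf : ∀ {n} → Subset n → List (Subset n)
subsetsOf []          = [] ∷ []
subsetsOf (false ∷ p) = map (false ∷_) (subsetsOf p)
subsetsOf (true  ∷ p) = map (false ∷_) (subsetsOf p) ++ map (true ∷_) (subsetsOf p)

length-subsetsOf : ∀ {n} (p : Subset n) → length (subsetsOf p) ≡ 2 ^ ∣ p ∣
length-subsetsOf []          = refl
length-subsetsOf (false ∷ p) = trans (length-map _ (subsetsOf p)) (length-subsetsOf p)
length-subsetsOf (true  ∷ p) = begin
  length (map (false ∷_) (subsetsOf p) ++ map (true ∷_) (subsetsOf p))
    ≡⟨ length-++ (map (false ∷_) (subsetsOf p)) ⟩
  length (map (false ∷_) (subsetsOf p)) + length (map (true ∷_) (subsetsOf p))
    ≡⟨ cong₂ _+_ (length-map _ (subsetsOf p)) (length-map _ (subsetsOf p)) ⟩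
  length (subsetsOf p) + length (subsetsOf p)
    ≡⟨ cong₂ _+_ (length-subsetsOf p) (trans (length-subsetsOf p) (sym (+-identityʳ _))) ⟩
  2 ^ ∣ p ∣ + (2 ^ ∣ p ∣ + 0) ∎
  where open ≡-Reasoning

∈-subsetsOf⁻ : ∀ {n} (p : Subset n) {q} → q ∈ₗ subsetsOf p → q ⊆ p
∈-subsetsOf⁻ []          {[]} _ ()
∈-subsetsOf⁻ (false ∷ p) q∈ with ∈-map⁻ (false ∷_) q∈
... | q , q∈′ , refl = out⊆ (∈-subsetsOf⁻ p q∈′)
∈-subsetsOf⁻ (true ∷ p) q∈ with ∈-++⁻ (map (false ∷_) (subsetsOf p)) q∈
... | inj₁ q∈ˡ with q , q∈′ , refl ← ∈-map⁻ (false ∷_) q∈ˡ = out⊆ (∈-subsetsOf⁻ p q∈′)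
... | inj₂ q∈ʳ with q , q∈′ , refl ← ∈-map⁻ (true ∷_) q∈ʳ  = in⊆in (∈-subsetsOf⁻ p q∈′)

∈-subsetsOf⁺ : ∀ {n} {p q : Subset n} → q ⊆ p → q ∈ₗ subsetsOf p
∈-subsetsOf⁺ {p = []}    {[]}        _   = Any.here refl
∈-subsetsOf⁺ {p = b ∷ p} {false ∷ q} q⊆p with b
... | false = ∈-map⁺ (false ∷_) (∈-subsetsOf⁺ (drop-∷-⊆ q⊆p))
... | true  = ∈-++⁺ˡ (∈-map⁺ (false ∷_) (∈-subsetsOf⁺ (drop-∷-⊆ q⊆p)))
∈-subsetsOf⁺ {p = b ∷ p} {true ∷ q}  q⊆p with q⊆p here
... | here = ∈-++⁺ʳ (map (false ∷_) (subsetsOf p)) (∈-map⁺ (true ∷_) (∈-subsetsOf⁺ (drop-∷-⊆ q⊆p)))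

subsetsOf-unique : ∀ {n} (p : Subset n) → Unique (subsetsOf p)
subsetsOf-unique []          = All.[] ∷ []
subsetsOf-unique (false ∷ p) = Unique.map⁺ ∷-injectiveʳ (subsetsOf-unique p)
subsetsOf-unique (true  ∷ p) = Unique.++⁺ (Unique.map⁺ ∷-injectiveʳ (subsetsOf-unique p))
                                          (Unique.map⁺ ∷-injectiveʳ (subsetsOf-unique p)) disjoint
  where
  disjoint : ∀ {q} → ¬ (q ∈ₗ map (false ∷_) (subsetsOf p) × q ∈ₗ map (true ∷_) (subsetsOf p))
  disjoint (q∈ˡ , q∈ʳ) with _ , _ , refl ← ∈-map⁻ (false ∷_) q∈ˡ with _ , _ , () ← ∈-map⁻ (true ∷_) q∈ʳ

module _ {n m} (h : Fin n → Vec Bool m) {S : Subset n} (indep : LinIndepOn h S) where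

  sumOver-injectiveOn : ∀ {T T′} → T ⊆ S → T′ ⊆ S → sumOver h T ≡ sumOver h T′ → T ≡ T′
  sumOver-injectiveOn {T} {T′} T⊆S T′⊆S eq = ⊕≡𝟎⇒≡ (indep _ (⊕-⊆ T⊆S T′⊆S) (sumOver-⊕≡𝟎 h T T′ eq))

  -- A missed y together with the 2^∣S∣ distinct sums over subsets of S would give
  -- 1 + 2^∣S∣ > 2^m distinct vectors of length m.
  sumOver-onto : m ≤ ∣ S ∣ → ∀ y → ∃ λ T → T ⊆ S × sumOver h T ≡ y
  sumOver-onto m≤∣S∣ y with any? (λ T → ≡-dec _≟_ (sumOver h T) y) (subsetsOf S)
  ... | yes hit = let T , T∈ , eq = find hit in T , ∈-subsetsOf⁻ S T∈ , eq
  ... | no miss = ⊥-elim (<-irrefl refl (begin-strict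
    2 ^ m                       ≤⟨ ^-monoʳ-≤ 2 m≤∣S∣ ⟩
    2 ^ ∣ S ∣                   ≡⟨ length-subsetsOf S ⟨
    length L                    <⟨ injective-into⇒≤-length (subsetsOf ⊤) F-injective (λ _ → ∈-subsetsOf⁺ ⊆⊤) ⟩
    length (subsetsOf (⊤ {m}))  ≡⟨ length-subsetsOf (⊤ {m}) ⟩
    2 ^ ∣ ⊤ {m} ∣               ≡⟨ cong (2 ^_) (∣⊤∣≡n m) ⟩
    2 ^ m                       ∎))
    where
    open ≤-Reasoning
    L = subsetsOf S

    F : Fin (suc (length L)) → Vec Bool m
    F zero    = y
    F (suc i) = sumOver h (List.lookup L i)

    F-injective : Injective _≡_ _≡_ F
    F-injective {zero}  {zero}  _  = refl
    F-injective {zero}  {suc j} eq = ⊥-elim (miss (lose (∈-lookup j) (sym eq)))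
    F-injective {suc i} {zero}  eq = ⊥-elim (miss (lose (∈-lookup i) eq))
    F-injective {suc i} {suc j} eq = cong suc (Unique⇒lookup-injective (subsetsOf-unique S)
      (sumOver-injectiveOn (∈-subsetsOf⁻ S (∈-lookup i)) (∈-subsetsOf⁻ S (∈-lookup j)) eq))

foldr-∨-tabulate⁻ : ∀ {k} (f : Fin k → Bool) → T (foldr _ _∨_ false (tabulate f)) → ∃ λ i → T (f i)
foldr-∨-tabulate⁻ {suc k} f t with Equivalence.to T-∨ t
... | inj₁ t₀ = zero , t₀
... | inj₂ t′ = let i , tᵢ = foldr-∨-tabulate⁻ (f ∘ suc) t′ in suc i , tᵢ

foldr-∨-tabulate⁺ : ∀ {k} (f : Fin k → Bool) i → T (f i) → T (foldr _ _∨_ false (tabulate f))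
foldr-∨-tabulate⁺ f zero    t = Equivalence.from T-∨ (inj₁ t)
foldr-∨-tabulate⁺ f (suc i) t = Equivalence.from T-∨ (inj₂ (foldr-∨-tabulate⁺ (f ∘ suc) i t))

∣p∣<n⇒∃∉ : ∀ {n} {p : Subset n} → ∣ p ∣ < n → ∃ λ x → x ∉ p
∣p∣<n⇒∃∉ {n} {p} ∣p∣<n = ¬∀⟶∃¬ n (_∈ p) (_∈? p) λ ∀∈p →
  <-irrefl (∣⊤∣≡n n) (≤-<-trans (p⊆q⇒∣p∣≤∣q∣ {p = ⊤} (λ {x} _ → ∀∈p x)) ∣p∣<n)

module _ {n} (P : Poset n) where
  open Poset P
  open IsPartialOrder isPartialOrder using () renaming (refl to ≼-refl; trans to ≼-trans; antisym to ≼-antisym)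

  ∈⟨⟩⁻ : ∀ {x b} → b ∈ ⟨_⟩ P x → ∃ λ a → a ∈ x × b ≼ a
  ∈⟨⟩⁻ {x} {b} b∈⟨x⟩ =
    let a , t = foldr-∨-tabulate⁻ _ (subst T (lookup∘tabulate _ b) (Equivalence.from T-≡ ([]=⇒lookup b∈⟨x⟩)))
        a∈x , b≼a = Equivalence.to T-∧ t
    in a , lookup⇒[]= a x (Equivalence.to T-≡ a∈x) , toWitness b≼a

  ∈⟨⟩⁺ : ∀ {x a b} → a ∈ x → b ≼ a → b ∈ ⟨_⟩ P x
  ∈⟨⟩⁺ {x} {a} {b} a∈x b≼a = lookup⇒[]= b (⟨_⟩ P x) (Equivalence.to T-≡ (subst T (sym (lookup∘tabulate _ b))
    (foldr-∨-tabulate⁺ _ a (Equivalence.from T-∧ (Equivalence.from T-≡ ([]=⇒lookup a∈x) , fromWitness b≼a)))))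

  ⊆⟨⟩ : ∀ {x} → x ⊆ ⟨_⟩ P x
  ⊆⟨⟩ a∈x = ∈⟨⟩⁺ a∈x ≼-refl

  ⟨⟩-isIdeal : ∀ {x} → IsIdeal P (⟨_⟩ P x)
  ⟨⟩-isIdeal {x} b∈⟨x⟩ c≼b = let a , a∈x , b≼a = ∈⟨⟩⁻ b∈⟨x⟩ in ∈⟨⟩⁺ {x} a∈x (≼-trans c≼b b≼a)

  ⟨⟩-least : ∀ {x J} → x ⊆ J → IsIdeal P J → ⟨_⟩ P x ⊆ J
  ⟨⟩-least x⊆J J-ideal b∈⟨x⟩ = let a , a∈x , b≼a = ∈⟨⟩⁻ b∈⟨x⟩ in J-ideal (x⊆J a∈x) b≼a

  wP≤∣ideal∣ : ∀ {x J} → x ⊆ J → IsIdeal P J → wP P x ≤ ∣ J ∣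
  wP≤∣ideal∣ x⊆J J-ideal = p⊆q⇒∣p∣≤∣q∣ (⟨⟩-least x⊆J J-ideal)

  ∣⟨⁅⁆⟩∣-strictMono : ∀ {a b} → b ≼ a → b ≢ a → ∣ ⟨_⟩ P ⁅ b ⁆ ∣ < ∣ ⟨_⟩ P ⁅ a ⁆ ∣
  ∣⟨⁅⁆⟩∣-strictMono {a} {b} b≼a b≢a = p⊂q⇒∣p∣<∣q∣ (⟨b⟩⊆⟨a⟩ , a , ⊆⟨⟩ (x∈⁅x⁆ a) , a∉⟨b⟩)
    where
    ⟨b⟩⊆⟨a⟩ : ⟨_⟩ P ⁅ b ⁆ ⊆ ⟨_⟩ P ⁅ a ⁆
    ⟨b⟩⊆⟨a⟩ = ⟨⟩-least (⁅x⁆⊆p (∈⟨⟩⁺ (x∈⁅x⁆ a) b≼a)) (⟨⟩-isIdeal {⁅ a ⁆})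
    a∉⟨b⟩ : a ∉ ⟨_⟩ P ⁅ b ⁆
    a∉⟨b⟩ a∈⟨b⟩ = let c , c∈⁅b⁆ , a≼c = ∈⟨⟩⁻ a∈⟨b⟩ in
      b≢a (≼-antisym b≼a (subst (a ≼_) (x∈⁅y⁆⇒x≡y b c∈⁅b⁆) a≼c))

  -- Descend strictly below a while staying outside K; the down-sets shrink, so this stops.
  minimal-∉ : ∀ {K} a → a ∉ K → ∃ λ z → z ∉ K × (∀ {y} → y ≼ z → y ∈ K ⊎ y ≡ z)
  minimal-∉ {K} a = go a (<-wellFounded _)
    where
    go : ∀ a → Acc _<_ ∣ ⟨_⟩ P ⁅ a ⁆ ∣ → a ∉ K → ∃ λ z → z ∉ K × (∀ {y} → y ≼ z → y ∈ K ⊎ y ≡ z)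
    go a (acc rec) a∉K with Fin.any? (λ b → (b ≼? a) ×-dec ¬? (b ≟ᶠ a) ×-dec ¬? (b ∈? K))
    ... | yes (b , b≼a , b≢a , b∉K) = go b (rec (∣⟨⁅⁆⟩∣-strictMono b≼a b≢a)) b∉K
    ... | no none = a , a∉K , below
      where
      below : ∀ {y} → y ≼ a → y ∈ K ⊎ y ≡ a
      below {y} y≼a with y ≟ᶠ a | y ∈? K
      ... | yes y≡a | _       = inj₂ y≡a
      ... | no _    | yes y∈K = inj₁ y∈K
      ... | no y≢a  | no y∉K  = ⊥-elim (none (y , y≼a , y≢a , y∉K))

  IsIdeal-∪⁅⁆ : ∀ {K z} → IsIdeal P K → (∀ {y} → y ≼ z → y ∈ K ⊎ y ≡ z) → IsIdeal P (K ∪ ⁅ z ⁆)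
  IsIdeal-∪⁅⁆ {K} {z} K-ideal z-minimal {a} {b} a∈K∪z b≼a with x∈p∪q⁻ K ⁅ z ⁆ a∈K∪z
  ... | inj₁ a∈K = x∈p∪q⁺ (inj₁ (K-ideal a∈K b≼a))
  ... | inj₂ a∈⁅z⁆ with refl ← x∈⁅y⁆⇒x≡y z a∈⁅z⁆ with z-minimal b≼a
  ...   | inj₁ b∈K = x∈p∪q⁺ (inj₁ b∈K)
  ...   | inj₂ refl = x∈p∪q⁺ (inj₂ (x∈⁅x⁆ b))

  IsIdeal-grow : ∀ {K} → IsIdeal P K → ∣ K ∣ < n → ∃ λ z → z ∉ K × IsIdeal P (K ∪ ⁅ z ⁆)
  IsIdeal-grow K-ideal ∣K∣<n =
    let a , a∉K = ∣p∣<n⇒∃∉ ∣K∣<n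
        z , z∉K , z-minimal = minimal-∉ a a∉K
    in z , z∉K , IsIdeal-∪⁅⁆ K-ideal z-minimal

  ideal-extend : ∀ {K} k → IsIdeal P K → ∣ K ∣ + k ≤ n →
                 ∃ λ J → IsIdeal P J × K ⊆ J × ∣ J ∣ ≡ ∣ K ∣ + k
  ideal-extend {K} zero    K-ideal _ = K , K-ideal , ⊆-refl , sym (+-identityʳ ∣ K ∣)
  ideal-extend {K} (suc k) K-ideal ∣K∣+1+k≤n =
    let z , z∉K , K∪z-ideal = IsIdeal-grow K-ideal (<-≤-trans (m<m+n ∣ K ∣ z<s) ∣K∣+1+k≤n)
        ∣K∪z∣+k≡ = trans (cong (_+ k) (∣p∪⁅x⁆∣≡1+∣p∣ z∉K)) (sym (+-suc ∣ K ∣ k))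
        J , J-ideal , K∪z⊆J , ∣J∣≡ = ideal-extend k K∪z-ideal (subst (_≤ n) (sym ∣K∪z∣+k≡) ∣K∣+1+k≤n)
    in J , J-ideal , K∪z⊆J ∘ x∈p∪q⁺ ∘ inj₁ , trans ∣J∣≡ ∣K∪z∣+k≡

  ⊆ideal⇒InBall : ∀ {r x J} → IsIdeal P J → ∣ J ∣ ≡ r → x ⊆ J → InBall P r x
  ⊆ideal⇒InBall J-ideal ∣J∣≡r x⊆J = subst (_ ≤_) ∣J∣≡r (wP≤∣ideal∣ x⊆J J-ideal)

  InBall⇒⊆ideal : ∀ {r x} → r ≤ n → InBall P r x → ∃ λ J → IsIdeal P J × ∣ J ∣ ≡ r × x ⊆ J
  InBall⇒⊆ideal {r} {x} r≤n wPx≤r =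
    let J , J-ideal , ⟨x⟩⊆J , ∣J∣≡ = ideal-extend (r ∸ wP P x) (⟨⟩-isIdeal {x})
                                       (subst (_≤ n) (sym (m+[n∸m]≡n wPx≤r)) r≤n)
    in J , J-ideal , trans ∣J∣≡ (m+[n∸m]≡n wPx≤r) , ⟨x⟩⊆J ∘ ⊆⟨⟩

unique-syndromes⇒IsPerfect :
  ∀ {n m} (P : Poset n) r (h : Fin n → Vec Bool m) →
  (∀ y → ∃ λ b → InBall P r b × sumOver h b ≡ y) →
  (∀ {b b′} → InBall P r b → InBall P r b′ → sumOver h b ≡ sumOver h b′ → b ≡ b′) →
  IsPerfect P r (Code h)
unique-syndromes⇒IsPerfect P r h onto injective x =
  let b , b∈B , sb≡sx = onto (sumOver h x) in
  (x ⊕ b , b , sumOver-⊕≡𝟎 h x b (sym sb≡sx) , b∈B , sym (⊕-cancelʳ x b)) ,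
  λ c b c′ b′ c∈C b∈B x≡c⊕b c′∈C b′∈B x≡c′⊕b′ →
    let b≡b′ = injective b∈B b′∈B (trans (syndrome c∈C x≡c⊕b) (sym (syndrome c′∈C x≡c′⊕b′))) in
    trans (codeword x≡c⊕b) (trans (cong (x ⊕_) b≡b′) (sym (codeword x≡c′⊕b′))) , b≡b′
  where
  syndrome : ∀ {c b} → Code h c → x ≡ c ⊕ b → sumOver h b ≡ sumOver h x
  syndrome {c} {b} c∈C x≡c⊕b = begin
    sumOver h b                ≡⟨ ⊕-identityˡ (sumOver h b) ⟨
    𝟎 ⊕ sumOver h b            ≡⟨ cong (_⊕ sumOver h b) c∈C ⟨
    sumOver h c ⊕ sumOver h b  ≡⟨ sumOver-⊕ h c b ⟨
    sumOver h (c ⊕ b)          ≡⟨ cong (sumOver h) x≡c⊕b ⟨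
    sumOver h x                ∎
    where open ≡-Reasoning

  codeword : ∀ {c b} → x ≡ c ⊕ b → c ≡ x ⊕ b
  codeword {c} {b} x≡c⊕b = trans (sym (⊕-cancelʳ c b)) (cong (_⊕ b) (sym x≡c⊕b))

module ThreeSubcubes
  {n m} (h : Fin n → Vec Bool m) (I : Subset n) {a₁ a₂ a₃ : Fin n}
  (a₁∉I : a₁ ∉ I) (a₂∉I : a₂ ∉ I) (a₃∉I : a₃ ∉ I)
  (a₁≢a₂ : a₁ ≢ a₂) (a₁≢a₃ : a₁ ≢ a₃) (a₂≢a₃ : a₂ ≢ a₃)
  (indep : LinIndepOn h (I ∪ ⁅ a₁ ⁆ ∪ ⁅ a₂ ⁆))
  {α : Subset n} (α⊆I : α ⊆ I) (h-a₃ : h a₃ ≡ sumOver h α ⊕ h a₁ ⊕ h a₂)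
  where

  S U A : Subset n
  S = I ∪ ⁅ a₁ ⁆ ∪ ⁅ a₂ ⁆
  U = S ∪ ⁅ a₃ ⁆
  A = α ⊕ ⁅ a₁ ⁆ ⊕ ⁅ a₂ ⁆ ⊕ ⁅ a₃ ⁆

  ∣S∣≡2+∣I∣ : ∣ S ∣ ≡ suc (suc ∣ I ∣)
  ∣S∣≡2+∣I∣ = begin
    ∣ I ∪ (⁅ a₁ ⁆ ∪ ⁅ a₂ ⁆) ∣    ≡⟨ cong ∣_∣ (∪-assoc I ⁅ a₁ ⁆ ⁅ a₂ ⁆) ⟨
    ∣ (I ∪ ⁅ a₁ ⁆) ∪ ⁅ a₂ ⁆ ∣    ≡⟨ ∣p∪⁅x⁆∣≡1+∣p∣ ([ a₂∉I , a₁≢a₂ ∘ sym ∘ x∈⁅y⁆⇒x≡y a₁ ] ∘ x∈p∪q⁻ I ⁅ a₁ ⁆) ⟩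
    suc ∣ I ∪ ⁅ a₁ ⁆ ∣           ≡⟨ cong suc (∣p∪⁅x⁆∣≡1+∣p∣ a₁∉I) ⟩
    suc (suc ∣ I ∣)              ∎
    where open ≡-Reasoning

  -- The ball B_P^{m−1}, once the hypothesis on the ideals of size m − 1 is used.
  InSubcube : Subset n → Set
  InSubcube b = b ⊆ I ∪ ⁅ a₁ ⁆ ⊎ b ⊆ I ∪ ⁅ a₂ ⁆ ⊎ b ⊆ I ∪ ⁅ a₃ ⁆

  I⊆U : I ⊆ U
  I⊆U = p⊆p∪q _ ∘ p⊆p∪q _

  a₁∈U : a₁ ∈ U
  a₁∈U = p⊆p∪q _ (x∈p∪q⁺ (inj₂ (x∈p∪q⁺ (inj₁ (x∈⁅x⁆ a₁)))))

  a₂∈U : a₂ ∈ U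
  a₂∈U = p⊆p∪q _ (x∈p∪q⁺ (inj₂ (x∈p∪q⁺ (inj₂ (x∈⁅x⁆ a₂)))))

  a₃∈U : a₃ ∈ U
  a₃∈U = x∈p∪q⁺ (inj₂ (x∈⁅x⁆ a₃))

  A⊆U : A ⊆ U
  A⊆U = ⊕-⊆ (⊕-⊆ (⊕-⊆ (I⊆U ∘ α⊆I) (⁅x⁆⊆p a₁∈U)) (⁅x⁆⊆p a₂∈U)) (⁅x⁆⊆p a₃∈U)

  a₁∈A : a₁ ∈ A
  a₁∈A = x∈p⊕q⁺ˡ (x∈p⊕q⁺ˡ (x∈p⊕q⁺ʳ (a₁∉I ∘ α⊆I) (x∈⁅x⁆ a₁)) (x≢y⇒x∉⁅y⁆ a₁≢a₂)) (x≢y⇒x∉⁅y⁆ a₁≢a₃)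

  a₂∈A : a₂ ∈ A
  a₂∈A = x∈p⊕q⁺ˡ (x∈p⊕q⁺ʳ (x∉p⊕q⁺ (a₂∉I ∘ α⊆I) (x≢y⇒x∉⁅y⁆ (a₁≢a₂ ∘ sym))) (x∈⁅x⁆ a₂))
                  (x≢y⇒x∉⁅y⁆ a₂≢a₃)

  a₃∈A : a₃ ∈ A
  a₃∈A = x∈p⊕q⁺ʳ (x∉p⊕q⁺ (x∉p⊕q⁺ (a₃∉I ∘ α⊆I) (x≢y⇒x∉⁅y⁆ (a₁≢a₃ ∘ sym))) (x≢y⇒x∉⁅y⁆ (a₂≢a₃ ∘ sym)))
                  (x∈⁅x⁆ a₃)

  A∈Code : Code h A
  A∈Code = begin
    sumOver h (α ⊕ ⁅ a₁ ⁆ ⊕ ⁅ a₂ ⁆ ⊕ ⁅ a₃ ⁆)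
      ≡⟨ sumOver-⊕ h (α ⊕ ⁅ a₁ ⁆ ⊕ ⁅ a₂ ⁆) ⁅ a₃ ⁆ ⟩
    sumOver h (α ⊕ ⁅ a₁ ⁆ ⊕ ⁅ a₂ ⁆) ⊕ sumOver h ⁅ a₃ ⁆
      ≡⟨ cong (_⊕ sumOver h ⁅ a₃ ⁆) (sumOver-⊕ h (α ⊕ ⁅ a₁ ⁆) ⁅ a₂ ⁆) ⟩
    sumOver h (α ⊕ ⁅ a₁ ⁆) ⊕ sumOver h ⁅ a₂ ⁆ ⊕ sumOver h ⁅ a₃ ⁆
      ≡⟨ cong (λ z → z ⊕ sumOver h ⁅ a₂ ⁆ ⊕ sumOver h ⁅ a₃ ⁆) (sumOver-⊕ h α ⁅ a₁ ⁆) ⟩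
    sumOver h α ⊕ sumOver h ⁅ a₁ ⁆ ⊕ sumOver h ⁅ a₂ ⁆ ⊕ sumOver h ⁅ a₃ ⁆
      ≡⟨ cong₂ _⊕_ (cong₂ _⊕_ (cong (sumOver h α ⊕_) (sumOver-⁅⁆ h a₁)) (sumOver-⁅⁆ h a₂))
                   (sumOver-⁅⁆ h a₃) ⟩
    sumOver h α ⊕ h a₁ ⊕ h a₂ ⊕ h a₃
      ≡⟨ cong (_⊕ h a₃) h-a₃ ⟨
    h a₃ ⊕ h a₃
      ≡⟨ ⊕-self (h a₃) ⟩
    𝟎 ∎
    where open ≡-Reasoning

  -- If a₃ ∉ d then d ⊆ S, where the h_i are independent; if a₃ ∈ d then d ⊕ A ⊆ S.
  codeword⊆U⇒𝟎⊎A : ∀ {d} → d ⊆ U → Code h d → d ≡ 𝟎 ⊎ d ≡ A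
  codeword⊆U⇒𝟎⊎A {d} d⊆U d∈Code with a₃ ∈? d
  ... | no a₃∉d = inj₁ (indep d d⊆S d∈Code)
    where
    d⊆S : d ⊆ S
    d⊆S j∈d with x∈p∪⁅y⁆⁻ (d⊆U j∈d)
    ... | inj₁ j∈S = j∈S
    ... | inj₂ refl = ⊥-elim (a₃∉d j∈d)
  ... | yes a₃∈d = inj₂ (⊕≡𝟎⇒≡ (indep (d ⊕ A) d⊕A⊆S d⊕A∈Code))
    where
    d⊕A∈Code : Code h (d ⊕ A)
    d⊕A∈Code = trans (sumOver-⊕ h d A) (trans (cong₂ _⊕_ d∈Code A∈Code) (⊕-self 𝟎))

    d⊕A⊆S : d ⊕ A ⊆ S
    d⊕A⊆S j∈d⊕A with x∈p∪⁅y⁆⁻ (⊕-⊆ d⊆U A⊆U j∈d⊕A)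
    ... | inj₁ j∈S = j∈S
    ... | inj₂ refl = ⊥-elim (x∈p∩q⇒x∉p⊕q a₃∈d a₃∈A j∈d⊕A)

  A⊈I∪⁅x⁆∪⁅y⁆ : ∀ {x y} → ¬ A ⊆ I ∪ ⁅ x ⁆ ∪ ⁅ y ⁆
  A⊈I∪⁅x⁆∪⁅y⁆ {x} {y} A⊆ = pigeonhole (outside-I a₁∈A a₁∉I) (outside-I a₂∈A a₂∉I) (outside-I a₃∈A a₃∉I)
    where
    outside-I : ∀ {a} → a ∈ A → a ∉ I → a ≡ x ⊎ a ≡ y
    outside-I a∈A a∉I = [ ⊥-elim ∘ a∉I , id ] (x∈p∪⁅y⁆∪⁅z⁆⁻ (A⊆ a∈A))

    pigeonhole : a₁ ≡ x ⊎ a₁ ≡ y → a₂ ≡ x ⊎ a₂ ≡ y → a₃ ≡ x ⊎ a₃ ≡ y → ⊥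
    pigeonhole (inj₁ e₁) (inj₁ e₂) _         = a₁≢a₂ (trans e₁ (sym e₂))
    pigeonhole (inj₂ e₁) (inj₂ e₂) _         = a₁≢a₂ (trans e₁ (sym e₂))
    pigeonhole (inj₁ e₁) (inj₂ _)  (inj₁ e₃) = a₁≢a₃ (trans e₁ (sym e₃))
    pigeonhole (inj₂ e₁) (inj₁ _)  (inj₂ e₃) = a₁≢a₃ (trans e₁ (sym e₃))
    pigeonhole (inj₁ _)  (inj₂ e₂) (inj₂ e₃) = a₂≢a₃ (trans e₂ (sym e₃))
    pigeonhole (inj₂ _)  (inj₁ e₂) (inj₁ e₃) = a₂≢a₃ (trans e₂ (sym e₃))

  InSubcube⇒⊆I∪⁅⁆ : ∀ {b} → InSubcube b → ∃ λ x → x ∈ U × b ⊆ I ∪ ⁅ x ⁆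
  InSubcube⇒⊆I∪⁅⁆ (inj₁ b⊆)        = a₁ , a₁∈U , b⊆
  InSubcube⇒⊆I∪⁅⁆ (inj₂ (inj₁ b⊆)) = a₂ , a₂∈U , b⊆
  InSubcube⇒⊆I∪⁅⁆ (inj₂ (inj₂ b⊆)) = a₃ , a₃∈U , b⊆

  InSubcube-sumOver-injective : ∀ {b b′} → InSubcube b → InSubcube b′ → sumOver h b ≡ sumOver h b′ → b ≡ b′
  InSubcube-sumOver-injective {b} {b′} β β′ eq =
    let x , x∈U , b⊆ = InSubcube⇒⊆I∪⁅⁆ β
        y , y∈U , b′⊆ = InSubcube⇒⊆I∪⁅⁆ β′
        b⊕b′⊆U = ⊕-⊆ (∪-⊆ I⊆U (⁅x⁆⊆p x∈U) ∘ b⊆) (∪-⊆ I⊆U (⁅x⁆⊆p y∈U) ∘ b′⊆)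
        b⊕b′≢A = λ b⊕b′≡A → A⊈I∪⁅x⁆∪⁅y⁆ (subst (_⊆ I ∪ ⁅ x ⁆ ∪ ⁅ y ⁆) b⊕b′≡A (⊕-⊆-∪⁅⁆ b⊆ b′⊆))
    in [ ⊕≡𝟎⇒≡ , ⊥-elim ∘ b⊕b′≢A ] (codeword⊆U⇒𝟎⊎A b⊕b′⊆U (sumOver-⊕≡𝟎 h b b′ eq))

  InSubcube-sumOver-onto : m ≤ ∣ S ∣ → ∀ y → ∃ λ b → InSubcube b × sumOver h b ≡ y
  InSubcube-sumOver-onto m≤∣S∣ y
    with T , T⊆S , T↦y ← sumOver-onto h indep m≤∣S∣ y
    with a₁ ∈? T | a₂ ∈? T
  ... | no a₁∉T  | _        = T , inj₂ (inj₁ (⊆∪⁅⁆∪⁅⁆-dropˡ T⊆S a₁∉T)) , T↦y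
  ... | yes _    | no a₂∉T  = T , inj₁ (⊆∪⁅⁆∪⁅⁆-dropʳ T⊆S a₂∉T) , T↦y
  ... | yes a₁∈T | yes a₂∈T = T ⊕ A , inj₂ (inj₂ T⊕A⊆I∪⁅a₃⁆) , T⊕A↦y
    where
    T⊕A⊆I∪⁅a₃⁆ : T ⊕ A ⊆ I ∪ ⁅ a₃ ⁆
    T⊕A⊆I∪⁅a₃⁆ j∈T⊕A with x∈p∪⁅y⁆⁻ (⊕-⊆ (p⊆p∪q _ ∘ T⊆S) A⊆U j∈T⊕A)
    ... | inj₂ refl = x∈p∪q⁺ (inj₂ (x∈⁅x⁆ a₃))
    ... | inj₁ j∈S with x∈p∪⁅y⁆∪⁅z⁆⁻ j∈S
    ...   | inj₁ j∈I         = x∈p∪q⁺ (inj₁ j∈I)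
    ...   | inj₂ (inj₁ refl) = ⊥-elim (x∈p∩q⇒x∉p⊕q a₁∈T a₁∈A j∈T⊕A)
    ...   | inj₂ (inj₂ refl) = ⊥-elim (x∈p∩q⇒x∉p⊕q a₂∈T a₂∈A j∈T⊕A)

    T⊕A↦y : sumOver h (T ⊕ A) ≡ y
    T⊕A↦y = trans (sumOver-⊕ h T A) (trans (cong₂ _⊕_ T↦y A∈Code) (⊕-identityʳ y))

proposition8 :
    ∀ {n : ℕ} (P : Poset n) (m : ℕ) → 2 ≤ m →
    (I : Subset n) (a₁ a₂ a₃ : Fin n) →
    IsIdeal P I → ∣ I ∣ ≡ m ∸ 2 →
    a₁ ∉ I → a₂ ∉ I → a₃ ∉ I →
    a₁ ≢ a₂ → a₁ ≢ a₃ → a₂ ≢ a₃ →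
    IsIdeal P (I ∪ ⁅ a₁ ⁆) → IsIdeal P (I ∪ ⁅ a₂ ⁆) → IsIdeal P (I ∪ ⁅ a₃ ⁆) →
    (∀ (J : Subset n) → IsIdeal P J → ∣ J ∣ ≡ m ∸ 1 →
       (J ≡ I ∪ ⁅ a₁ ⁆) ⊎ (J ≡ I ∪ ⁅ a₂ ⁆) ⊎ (J ≡ I ∪ ⁅ a₃ ⁆)) →
    (h : Fin n → Vec Bool m) →
    LinIndepOn h (I ∪ ⁅ a₁ ⁆ ∪ ⁅ a₂ ⁆) →
    (Σ (Subset n) λ α → α ⊆ I × h a₃ ≡ sumOver h α ⊕ h a₁ ⊕ h a₂) →
    IsPerfect P (m ∸ 1) (Code h)
-- The patterns make m definitionally 2 + ∣ I ∣.
proposition8 {n} P _ (s≤s (s≤s z≤n)) I a₁ a₂ a₃ _ refl a₁∉I a₂∉I a₃∉I a₁≢a₂ a₁≢a₃ a₂≢a₃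
             ideal₁ ideal₂ ideal₃ only h indep (α , α⊆I , h-a₃) =
  unique-syndromes⇒IsPerfect P (suc ∣ I ∣) h
    (λ y → let b , b∈ , b↦y = InSubcube-sumOver-onto (≤-reflexive (sym ∣S∣≡2+∣I∣)) y
           in b , InSubcube⇒InBall b∈ , b↦y)
    (λ b∈B b′∈B → InSubcube-sumOver-injective (InBall⇒InSubcube b∈B) (InBall⇒InSubcube b′∈B))
  where
  open ThreeSubcubes h I a₁∉I a₂∉I a₃∉I a₁≢a₂ a₁≢a₃ a₂≢a₃ indep α⊆I h-a₃

  InSubcube⇒InBall : ∀ {b} → InSubcube b → InBall P (suc ∣ I ∣) b
  InSubcube⇒InBall (inj₁ b⊆)        = ⊆ideal⇒InBall P ideal₁ (∣p∪⁅x⁆∣≡1+∣p∣ a₁∉I) b⊆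
  InSubcube⇒InBall (inj₂ (inj₁ b⊆)) = ⊆ideal⇒InBall P ideal₂ (∣p∪⁅x⁆∣≡1+∣p∣ a₂∉I) b⊆
  InSubcube⇒InBall (inj₂ (inj₂ b⊆)) = ⊆ideal⇒InBall P ideal₃ (∣p∪⁅x⁆∣≡1+∣p∣ a₃∉I) b⊆

  InBall⇒InSubcube : ∀ {b} → InBall P (suc ∣ I ∣) b → InSubcube b
  InBall⇒InSubcube b∈B
    with J , J-ideal , ∣J∣≡ , b⊆J ← InBall⇒⊆ideal P (subst (_≤ n) (∣p∪⁅x⁆∣≡1+∣p∣ a₁∉I) (∣p∣≤n (I ∪ ⁅ a₁ ⁆))) b∈B
    with only J J-ideal ∣J∣≡
  ... | inj₁ refl        = inj₁ b⊆J
  ... | inj₂ (inj₁ refl) = inj₂ (inj₁ b⊆J)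
  ... | inj₂ (inj₂ refl) = inj₂ (inj₂ b⊆J)
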